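{- Every connected component of a finite equistarable bipartite graph is either a star or $2$-internally extendable.
   Context: A star is a graph isomorphic to $K_{1,n}$, $n\ge1$. A matching $M$ is a perfect internal matching if every vertex not covered by $M$ has degree $1$. A connected graph is $2$-internally extendable if it contains a matching with $2$ edges and every such matching is contained in a perfect internal matching. For a vertex $v$, $E(v)$ denotes the set of edges incident with $v$; such a star is maximal if not properly contained in another star $E(u)$. A graph $G=(V,E)$ without isolated vertices is equistarable if there is $\varphi:E\to\mathbb{R}_+$ such that for all $F\subseteq E$, $F$ is a maximal star iff $\sum_{e\in F}\varphi(e)=1$.
   Formalization: The weights φ witnessing equistarability take values in the nonnegative rationals rather than in $\mathbb{R}_+$. -}

module Defs where

open import Data.Nat using (ℕ; zero; suc)
open import Data.Fin using (Fin; zero; suc)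
open import Data.Bool using (Bool; true; false; if_then_else_)
open import Data.Product using (Σ; ∃; ∃-syntax; _×_; _,_; proj₁; proj₂)
open import Data.Sum using (_⊎_)
open import Data.Rational using (ℚ; 0ℚ; 1ℚ; _+_; _≤_)
open import Relation.Binary.PropositionalEquality using (_≡_; _≢_)
open import Relation.Nullary using (¬_)
open import Function.Bundles using (_⇔_)

SamePair : ∀ {n} → Fin n × Fin n → Fin n × Fin n → Set
SamePair (a , b) (c , d) = (a ≡ c × b ≡ d) ⊎ (a ≡ d × b ≡ c)

record Graph : Set where
  field
    n        : ℕ
    m        : ℕ
    ends     : Fin m → Fin n × Fin n
    loopless : ∀ e → proj₁ (ends e) ≢ proj₂ (ends e)
    simple   : ∀ e f → SamePair (ends e) (ends f) → e ≡ f

module _ (G : Graph) where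
  open Graph G

  Vertex : Set
  Vertex = Fin n

  Edge : Set
  Edge = Fin m

  EdgeSet : Set
  EdgeSet = Edge → Bool

  Incident : Vertex → Edge → Set
  Incident v e = (proj₁ (ends e) ≡ v) ⊎ (proj₂ (ends e) ≡ v)

  Adj : Vertex → Vertex → Set
  Adj u v = ∃[ e ] SamePair (ends e) (u , v)

  NoIsolated : Set
  NoIsolated = ∀ v → ∃[ e ] Incident v e

  Bipartite : Set
  Bipartite = Σ (Vertex → Bool) λ c → (∀ e → c (proj₁ (ends e)) ≢ c (proj₂ (ends e)))

  StarSub : Vertex → Vertex → Set
  StarSub u w = ∀ e → Incident u e → Incident w e

  StarProperSub : Vertex → Vertex → Set
  StarProperSub u w = StarSub u w × (∃[ e ] (Incident w e × ¬ Incident u e))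

  IsMaximalStar : EdgeSet → Set
  IsMaximalStar F = ∃[ v ] ((∀ e → (F e ≡ true) ⇔ Incident v e)
                             × (∀ u → ¬ StarProperSub v u))

  sumℚ : (k : ℕ) → (Fin k → ℚ) → ℚ
  sumℚ zero    f = 0ℚ
  sumℚ (suc k) f = f zero + sumℚ k (λ i → f (suc i))

  weight : (Edge → ℚ) → EdgeSet → ℚ
  weight φ F = sumℚ m (λ e → if F e then φ e else 0ℚ)

  Equistarable : Set
  Equistarable = NoIsolated ×
    (∃[ φ ] ((∀ e → 0ℚ ≤ φ e) × (∀ (F : EdgeSet) → IsMaximalStar F ⇔ (weight φ F ≡ 1ℚ))))

  data Reach (u : Vertex) : Vertex → Set where
    here : Reach u u
    step : ∀ {w x} → Reach u w → Adj w x → Reach u x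

  -- The connected component containing v: vertices reachable from v,
  -- edges with an endpoint reachable from v.
  InComp : Vertex → Vertex → Set
  InComp v u = Reach v u

  CompEdge : Vertex → Edge → Set
  CompEdge v e = Reach v (proj₁ (ends e))

  Deg1 : Vertex → Set
  Deg1 u = ∃[ e ] (Incident u e × (∀ f → Incident u f → f ≡ e))

  -- the component of v is a star, i.e. isomorphic to K_{1,k}, k ≥ 1:
  -- a centre c, at least one other vertex, every other vertex adjacent to c,
  -- and every edge of the component incident with c.
  CompIsStar : Vertex → Set
  CompIsStar v = ∃[ c ] (InComp v c
                   × (∃[ u ] (InComp v u × u ≢ c))
                   × (∀ u → InComp v u → u ≢ c → Adj c u)
                   × (∀ e → CompEdge v e → Incident c e))

  IsCompMatching : Vertex → EdgeSet → Set
  IsCompMatching v M = (∀ e → M e ≡ true → CompEdge v e)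
    × (∀ e f u → M e ≡ true → M f ≡ true → Incident u e → Incident u f → e ≡ f)

  Covered : EdgeSet → Vertex → Set
  Covered M u = ∃[ e ] (M e ≡ true × Incident u e)

  IsCompPIM : Vertex → EdgeSet → Set
  IsCompPIM v M = IsCompMatching v M
    × (∀ u → InComp v u → ¬ Covered M u → Deg1 u)

  Is2Matching : Vertex → Edge → Edge → Set
  Is2Matching v e f = CompEdge v e × CompEdge v f × e ≢ f
    × (∀ u → Incident u e → ¬ Incident u f)

  Comp2IntExt : Vertex → Set
  Comp2IntExt v = (∃[ e ] ∃[ f ] Is2Matching v e f)
    × (∀ e f → Is2Matching v e f →
         ∃[ M ] (IsCompPIM v M × M e ≡ true × M f ≡ true))

-- If the component of v has no two disjoint edges, its edges pairwise meet; a bipartite graph has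
-- no triangle, so they all share a vertex and the component is a star.
--
-- Otherwise let e₀, f₀ be disjoint edges of the component. For equistarable weights φ the star of a
-- vertex of degree ≥ 2 is maximal, hence has weight 1; every star lies in a maximal one, hence has
-- weight ≤ 1; and every edge has positive weight, since toggling a weightless edge in a maximal star
-- would give another maximal star. It suffices to find a matching M of edges avoiding the endpoints
-- of e₀ and f₀ that covers every other vertex of degree ≥ 2: the edges of M in the component together
-- with e₀ and f₀ form a perfect internal matching. M is grown one vertex s at a time along alternating
-- walks from s, which reach either an unmatched vertex on the far side (augment) or a vertex of degree
-- 1 on the side of s (unmatch it, then augment). If neither happens, the near vertices X and far
-- vertices Y reached all have stars of weight 1, |X| = |Y| + 1 through M, and every edge at X ends in
-- Y or at the far endpoints b, d of e₀, f₀. Comparing weights gives w(E(b)) + w(E(d)) = 1 + w(T) for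
-- an edge set T containing e₀ and f₀, which positivity and the bound 1 rule out.

module Submission where

open import Defs
open import Data.Nat using (ℕ; zero; suc; s≤s) renaming (_<_ to _<ℕ_; _≤_ to _≤ℕ_; _+_ to _+ℕ_)
import Data.Nat.Properties as ℕ
open import Data.Fin using (Fin; zero; suc)
open import Data.Fin.Properties using (_≟_; any?; all?; suc-injective)
open import Data.Fin.Subset using (Subset; ⁅_⁆; _∪_; ∣_∣) renaming (_∈_ to _∈ˢ_)
open import Data.Fin.Subset.Properties using (_∈?_; x∈⁅x⁆; x∈⁅y⁆⇒x≡y; x∈p∪q⁺; x∈p∪q⁻; q⊆p∪q; p⊂q⇒∣p∣<∣q∣; ∣p∣≤n)
open import Data.Bool using (Bool; true; false; if_then_else_; _∧_; _∨_; not)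
open import Data.Bool.Properties using (∧-identityʳ; ∨-zeroʳ; ¬-not; not-¬; not-involutive; not-injective)
import Data.Bool as Bool
open import Data.Product using (Σ; ∃-syntax; _×_; _,_; proj₁; proj₂)
open import Data.Sum using (_⊎_; inj₁; inj₂; [_,_]′)
open import Data.Rational using (ℚ; 0ℚ; 1ℚ; _+_; _≤_; _<_)
import Data.Rational.Properties as ℚ
open import Algebra.Properties.Group ℚ.+-0-group using (∙-cancelˡ)
open import Algebra.Properties.CommutativeMonoid.Sum ℚ.+-0-commutativeMonoid
  using (sum; sum-cong-≗; ∑-distrib-+; ∑-comm; sum-replicate-zero)
open import Relation.Binary.PropositionalEquality using (_≡_; _≢_; refl; sym; trans; cong; cong₂; subst; module ≡-Reasoning)
open import Relation.Nullary using (¬_; Dec; yes; no; does; contradiction)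
open import Relation.Binary.Definitions using (tri<; tri≈; tri>)
open import Relation.Nullary.Decidable using (dec-true; dec-false; does-⇔; decidable-stable; _×-dec_; _⊎-dec_; _→-dec_; ¬?; map′)
open import Function.Bundles using (_⇔_; mk⇔; module Equivalence)
open Equivalence using (to; from)
open import Data.Vec.Functional using (updateAt)
open import Data.Vec.Functional.Properties using (updateAt-updates; updateAt-minimal)
open import Data.Empty using (⊥; ⊥-elim)
open import Function using (_∘_; const)
open import Data.List using (List; []; _∷_; allFin)
open import Data.List.Relation.Unary.Any using (here; there)
open import Data.List.Membership.Propositional using (_∈_)
open import Data.List.Membership.Propositional.Properties using (∈-allFin)

dec-true⁻¹ : ∀ {A : Set} (a? : Dec A) → does a? ≡ true → A
dec-true⁻¹ (yes a) _ = a

infixr 7 [_]·_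

[_]·_ : Bool → ℚ → ℚ
[ b ]· x = if b then x else 0ℚ

[]·-zero : ∀ b → [ b ]· 0ℚ ≡ 0ℚ
[]·-zero true  = refl
[]·-zero false = refl

[]·-∨ : ∀ a b x → (a ≡ true → b ≡ false) → [ a ∨ b ]· x ≡ [ a ]· x + [ b ]· x
[]·-∨ true  b     x disj rewrite disj refl = sym (ℚ.+-identityʳ x)
[]·-∨ false b     x _    = sym (ℚ.+-identityˡ _)

[]·-split-⇒ : ∀ a b x → (a ≡ true → b ≡ true) → [ b ]· x ≡ [ a ]· x + [ b ∧ not a ]· x
[]·-split-⇒ true  b x a⇒b rewrite a⇒b refl = sym (ℚ.+-identityʳ x)
[]·-split-⇒ false b x _   rewrite ∧-identityʳ b = sym (ℚ.+-identityˡ _)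

∑-mono-≤ : ∀ {k} {f g : Fin k → ℚ} → (∀ i → f i ≤ g i) → sum f ≤ sum g
∑-mono-≤ {zero}  _   = ℚ.≤-refl
∑-mono-≤ {suc k} f≤g = ℚ.+-mono-≤ (f≤g zero) (∑-mono-≤ (f≤g ∘ suc))

∑-zero : ∀ {k} {f : Fin k → ℚ} → (∀ i → f i ≡ 0ℚ) → sum f ≡ 0ℚ
∑-zero {k} f≡0 = trans (sum-cong-≗ f≡0) (sum-replicate-zero k)

∑-single : ∀ {k} (f : Fin k → ℚ) (j : Fin k) → (∀ i → i ≢ j → f i ≡ 0ℚ) → sum f ≡ f j
∑-single f zero    rest = trans (cong (f zero +_) (∑-zero λ i → rest (suc i) λ ())) (ℚ.+-identityʳ _)
∑-single f (suc j) rest = begin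
  f zero + sum (f ∘ suc) ≡⟨ cong (_+ sum (f ∘ suc)) (rest zero λ ()) ⟩
  0ℚ + sum (f ∘ suc)     ≡⟨ ℚ.+-identityˡ _ ⟩
  sum (f ∘ suc)          ≡⟨ ∑-single (f ∘ suc) j (λ i i≢j → rest (suc i) (i≢j ∘ suc-injective)) ⟩
  f (suc j)              ∎
  where open ≡-Reasoning

∑-restrict-cong : ∀ {k} (P : Fin k → Bool) {f g : Fin k → ℚ} → (∀ i → P i ≡ true → f i ≡ g i) →
                  sum (λ i → [ P i ]· f i) ≡ sum (λ i → [ P i ]· g i)
∑-restrict-cong P f≡g = sum-cong-≗ pointwise
  where
  pointwise : ∀ i → [ P i ]· _ ≡ [ P i ]· _
  pointwise i with P i in Pi
  ... | true  = f≡g i Pi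
  ... | false = refl

[]·-distrib-∑ : ∀ {k} b (f : Fin k → ℚ) → [ b ]· sum f ≡ sum (λ i → [ b ]· f i)
[]·-distrib-∑ true  f = refl
[]·-distrib-∑ {k} false f = sym (sum-replicate-zero k)

∑-fibres : ∀ {k l} (π : Fin k → Fin l) (P : Fin l → Bool) (h : Fin k → ℚ) →
           sum (λ e → [ P (π e) ]· h e) ≡ sum (λ v → [ P v ]· sum (λ e → [ does (π e ≟ v) ]· h e))
∑-fibres π P h = sym (begin
  sum (λ v → [ P v ]· sum (λ e → [ does (π e ≟ v) ]· h e))
    ≡⟨ sum-cong-≗ (λ v → []·-distrib-∑ (P v) (λ e → [ does (π e ≟ v) ]· h e)) ⟩
  sum (λ v → sum (λ e → [ P v ]· [ does (π e ≟ v) ]· h e))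
    ≡⟨ ∑-comm (λ v e → [ P v ]· [ does (π e ≟ v) ]· h e) ⟩
  sum (λ e → sum (λ v → [ P v ]· [ does (π e ≟ v) ]· h e))
    ≡⟨ sum-cong-≗ (λ e → ∑-single _ (π e) (off-fibre e)) ⟩
  sum (λ e → [ P (π e) ]· [ does (π e ≟ π e) ]· h e)
    ≡⟨ sum-cong-≗ (λ e → cong (λ b → [ P (π e) ]· [ b ]· h e) (dec-true (π e ≟ π e) refl)) ⟩
  sum (λ e → [ P (π e) ]· h e) ∎)
  where
  open ≡-Reasoning
  off-fibre : ∀ e v → v ≢ π e → [ P v ]· [ does (π e ≟ v) ]· h e ≡ 0ℚ
  off-fibre e v v≢πe rewrite dec-false (π e ≟ v) (v≢πe ∘ sym) = []·-zero (P v)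

∑-point : ∀ {k} (f : Fin k → ℚ) j → sum (λ i → [ does (i ≟ j) ]· f i) ≡ f j
∑-point f j = trans (∑-single _ j off) (cong (λ b → [ b ]· f j) (dec-true (j ≟ j) refl))
  where
  off : ∀ i → i ≢ j → [ does (i ≟ j) ]· f i ≡ 0ℚ
  off i i≢j rewrite dec-false (i ≟ j) i≢j = refl

∑-split-point : ∀ {k} (P : Fin k → Bool) (f : Fin k → ℚ) {j} → P j ≡ true →
                sum (λ i → [ P i ]· f i) ≡ f j + sum (λ i → [ P i ∧ not (does (i ≟ j)) ]· f i)
∑-split-point P f {j} Pj = begin
  sum (λ i → [ P i ]· f i)
    ≡⟨ sum-cong-≗ (λ i → []·-split-⇒ (does (i ≟ j)) (P i) (f i) (at-j i)) ⟩
  sum (λ i → [ does (i ≟ j) ]· f i + [ P i ∧ not (does (i ≟ j)) ]· f i)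
    ≡⟨ ∑-distrib-+ (λ i → [ does (i ≟ j) ]· f i) (λ i → [ P i ∧ not (does (i ≟ j)) ]· f i) ⟩
  sum (λ i → [ does (i ≟ j) ]· f i) + sum (λ i → [ P i ∧ not (does (i ≟ j)) ]· f i)
    ≡⟨ cong (_+ sum (λ i → [ P i ∧ not (does (i ≟ j)) ]· f i)) (∑-point f j) ⟩
  f j + sum (λ i → [ P i ∧ not (does (i ≟ j)) ]· f i) ∎
  where
  open ≡-Reasoning
  at-j : ∀ i → does (i ≟ j) ≡ true → P i ≡ true
  at-j i i≡j rewrite dec-true⁻¹ (i ≟ j) i≡j = Pj

count : ∀ {k} → (Fin k → Bool) → ℚ
count P = sum (λ i → [ P i ]· 1ℚ)

overshoot-absurd : ∀ a b c t → a + b ≡ 1ℚ + t → a + c ≤ t → b ≤ 1ℚ → 0ℚ < c → ⊥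
overshoot-absurd a b c t a+b≡1+t a+c≤t b≤1 0<c = ℚ.<-irrefl refl (begin-strict
  a + 1ℚ         ≡⟨ ℚ.+-comm a 1ℚ ⟩
  1ℚ + a         ≡⟨ ℚ.+-identityʳ (1ℚ + a) ⟨
  (1ℚ + a) + 0ℚ  <⟨ ℚ.+-monoʳ-< (1ℚ + a) 0<c ⟩
  (1ℚ + a) + c   ≡⟨ ℚ.+-assoc 1ℚ a c ⟩
  1ℚ + (a + c)   ≤⟨ ℚ.+-monoʳ-≤ 1ℚ a+c≤t ⟩
  1ℚ + t         ≡⟨ a+b≡1+t ⟨
  a + b          ≤⟨ ℚ.+-monoʳ-≤ a b≤1 ⟩
  a + 1ℚ         ∎)
  where open ℚ.≤-Reasoning

module Walks {n : ℕ} (Step : Fin n → Fin n → Set) where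

  infixl 5 _▷_

  data Walk (s : Fin n) : Fin n → Set where
    start : Walk s s
    _▷_   : ∀ {u w} → Walk s u → Step u w → Walk s w

  length : ∀ {s w} → Walk s w → ℕ
  length start   = zero
  length (p ▷ _) = suc (length p)

  module _ (step? : ∀ u w → Dec (Step u w)) (s : Fin n) where

    private
      Sound Closed : Subset n → Set
      Sound S  = ∀ {w} → w ∈ˢ S → Walk s w
      Closed S = ∀ {u w} → u ∈ˢ S → Step u w → w ∈ˢ S

      -- Each round adds a vertex to S, so n rounds of fuel suffice.
      grow : ∀ fuel S → n <ℕ fuel +ℕ ∣ S ∣ → Sound S → s ∈ˢ S →
             ∃[ S′ ] (Sound S′ × Closed S′ × s ∈ˢ S′)
      grow zero S n<∣S∣ _ _ = contradiction (∣p∣≤n S) (ℕ.<⇒≱ n<∣S∣)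
      grow (suc fuel) S bound sound s∈S
        with any? (λ u → any? λ w → (u ∈? S) ×-dec (step? u w ×-dec ¬? (w ∈? S)))
      ... | yes (u , w , u∈S , u→w , w∉S) = grow fuel (⁅ w ⁆ ∪ S) bound′ sound′ (q⊆p∪q ⁅ w ⁆ S s∈S)
        where
        bound′ : n <ℕ fuel +ℕ ∣ ⁅ w ⁆ ∪ S ∣
        bound′ = ℕ.≤-trans (subst (n <ℕ_) (sym (ℕ.+-suc fuel ∣ S ∣)) bound)
                   (ℕ.+-monoʳ-≤ fuel (p⊂q⇒∣p∣<∣q∣ (q⊆p∪q ⁅ w ⁆ S , w , x∈p∪q⁺ (inj₁ (x∈⁅x⁆ w)) , w∉S)))
        sound′ : Sound (⁅ w ⁆ ∪ S)
        sound′ x∈ with x∈p∪q⁻ ⁅ w ⁆ S x∈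
        ... | inj₁ x∈⁅w⁆ rewrite x∈⁅y⁆⇒x≡y w x∈⁅w⁆ = sound u∈S ▷ u→w
        ... | inj₂ x∈S = sound x∈S
      ... | no no-exit = S , sound , closed , s∈S
        where
        closed : Closed S
        closed {u} {w} u∈S u→w with w ∈? S
        ... | yes w∈S = w∈S
        ... | no w∉S = contradiction (u , w , u∈S , u→w , w∉S) no-exit

    walk? : ∀ w → Dec (Walk s w)
    walk? w with grow (suc n) ⁅ s ⁆ (ℕ.m≤m+n (suc n) _) sound₀ (x∈⁅x⁆ s)
      where
      sound₀ : Sound ⁅ s ⁆
      sound₀ x∈ rewrite x∈⁅y⁆⇒x≡y s x∈ = start
    ... | S , sound , closed , s∈S with w ∈? S
    ... | yes w∈S = yes (sound w∈S)
    ... | no w∉S = no (w∉S ∘ inside)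
      where
      inside : ∀ {x} → Walk s x → x ∈ˢ S
      inside start    = s∈S
      inside (p ▷ st) = closed (inside p) st

module GraphFacts (G : Graph) where
  open Graph G

  Incident? : ∀ v e → Dec (Incident G v e)
  Incident? v e = (proj₁ (ends e) ≟ v) ⊎-dec (proj₂ (ends e) ≟ v)

  starAt : Vertex G → EdgeSet G
  starAt v e = does (Incident? v e)

  samePair? : (p q : Vertex G × Vertex G) → Dec (SamePair p q)
  samePair? (a , b) (c , d) = ((a ≟ c) ×-dec (b ≟ d)) ⊎-dec ((a ≟ d) ×-dec (b ≟ c))

  module _ {e : Edge G} {x y : Vertex G} where

    samePair⇒incident : SamePair (ends e) (x , y) → Incident G x e × Incident G y e
    samePair⇒incident (inj₁ (p , q)) = inj₁ p , inj₂ q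
    samePair⇒incident (inj₂ (p , q)) = inj₂ q , inj₁ p

    samePair-endpoint : ∀ {u} → SamePair (ends e) (x , y) → Incident G u e → u ≡ x ⊎ u ≡ y
    samePair-endpoint (inj₁ (p , q)) (inj₁ r) = inj₁ (trans (sym r) p)
    samePair-endpoint (inj₁ (p , q)) (inj₂ r) = inj₂ (trans (sym r) q)
    samePair-endpoint (inj₂ (p , q)) (inj₁ r) = inj₂ (trans (sym r) p)
    samePair-endpoint (inj₂ (p , q)) (inj₂ r) = inj₁ (trans (sym r) q)

    samePair-swap : SamePair (ends e) (x , y) → SamePair (ends e) (y , x)
    samePair-swap (inj₁ p) = inj₂ p
    samePair-swap (inj₂ p) = inj₁ p

    samePair-distinct : SamePair (ends e) (x , y) → x ≢ y
    samePair-distinct (inj₁ (p , q)) x≡y = loopless e (trans p (trans x≡y (sym q)))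
    samePair-distinct (inj₂ (p , q)) x≡y = loopless e (trans p (trans (sym x≡y) (sym q)))

    incident⇒samePair : Incident G x e → Incident G y e → x ≢ y → SamePair (ends e) (x , y)
    incident⇒samePair (inj₁ p) (inj₁ q) x≢y = contradiction (trans (sym p) q) x≢y
    incident⇒samePair (inj₁ p) (inj₂ q) _   = inj₁ (p , q)
    incident⇒samePair (inj₂ p) (inj₁ q) _   = inj₂ (q , p)
    incident⇒samePair (inj₂ p) (inj₂ q) x≢y = contradiction (trans (sym p) q) x≢y

  samePair-unique : ∀ {e f x y} → SamePair (ends e) (x , y) → SamePair (ends f) (x , y) → e ≡ f
  samePair-unique {e} {f} (inj₁ (p , q)) (inj₁ (r , s)) = simple e f (inj₁ (trans p (sym r) , trans q (sym s)))
  samePair-unique {e} {f} (inj₁ (p , q)) (inj₂ (r , s)) = simple e f (inj₂ (trans p (sym s) , trans q (sym r)))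
  samePair-unique {e} {f} (inj₂ (p , q)) (inj₁ (r , s)) = simple e f (inj₂ (trans p (sym s) , trans q (sym r)))
  samePair-unique {e} {f} (inj₂ (p , q)) (inj₂ (r , s)) = simple e f (inj₁ (trans p (sym r) , trans q (sym s)))

  otherEnd : ∀ {e v} → Incident G v e → ∃[ w ] SamePair (ends e) (v , w)
  otherEnd {e} (inj₁ p) = proj₂ (ends e) , inj₁ (p , refl)
  otherEnd {e} (inj₂ p) = proj₁ (ends e) , inj₂ (refl , p)

  Adj? : ∀ u w → Dec (Adj G u w)
  Adj? u w = any? (λ e → samePair? (ends e) (u , w))

  open Walks (Adj G) using (Walk; start; _▷_; walk?)

  reach? : ∀ v u → Dec (Reach G v u)
  reach? v u = map′ fromWalk toWalk (walk? Adj? v u)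
    where
    fromWalk : ∀ {x} → Walk v x → Reach G v x
    fromWalk start    = here
    fromWalk (p ▷ a) = step (fromWalk p) a
    toWalk : ∀ {x} → Reach G v x → Walk v x
    toWalk here       = start
    toWalk (step r a) = toWalk r ▷ a

  compEdge? : ∀ v e → Dec (CompEdge G v e)
  compEdge? v e = reach? v (proj₁ (ends e))

  reach⇒compEdge : ∀ {v u e} → Reach G v u → Incident G u e → CompEdge G v e
  reach⇒compEdge r (inj₁ p) = subst (Reach G _) (sym p) r
  reach⇒compEdge {e = e} r (inj₂ p) = step r (e , inj₂ (refl , p))

  compEdge⇒reach : ∀ {v e u} → CompEdge G v e → Incident G u e → Reach G v u
  compEdge⇒reach c (inj₁ p) = subst (Reach G _) p c
  compEdge⇒reach {e = e} c (inj₂ p) = subst (Reach G _) p (step c (e , inj₁ (refl , refl)))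

  has-2-matching? : ∀ v → Dec (∃[ e ] ∃[ f ] Is2Matching G v e f)
  has-2-matching? v = any? λ e → any? λ f →
    compEdge? v e ×-dec (compEdge? v f ×-dec (¬? (e ≟ f) ×-dec all? (λ u → Incident? u e →-dec ¬? (Incident? u f))))

  Deg≥2 : Vertex G → Set
  Deg≥2 v = ∃[ g ] ∃[ h ] (g ≢ h × Incident G v g × Incident G v h)

  deg≥2? : ∀ v → Dec (Deg≥2 v)
  deg≥2? v = any? (λ g → any? (λ h → ¬? (g ≟ h) ×-dec (Incident? v g ×-dec Incident? v h)))

  ¬deg≥2⇒unique : ∀ {v g h} → ¬ Deg≥2 v → Incident G v g → Incident G v h → h ≡ g
  ¬deg≥2⇒unique {v} {g} {h} ¬deg≥2 vg vh with h ≟ g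
  ... | yes h≡g = h≡g
  ... | no h≢g  = contradiction (h , g , h≢g , vh , vg) ¬deg≥2

  meet-or-disjoint : ∀ e f → (∃[ u ] (Incident G u e × Incident G u f)) ⊎ (∀ u → Incident G u e → ¬ Incident G u f)
  meet-or-disjoint e f with Incident? (proj₁ (ends e)) f | Incident? (proj₂ (ends e)) f
  ... | yes p∈f | _       = inj₁ (_ , inj₁ refl , p∈f)
  ... | no _    | yes q∈f = inj₁ (_ , inj₂ refl , q∈f)
  ... | no p∉f  | no q∉f  = inj₂ λ where
    u (inj₁ refl) → p∉f
    u (inj₂ refl) → q∉f

  starAt-spec : ∀ v e → starAt v e ≡ true ⇔ Incident G v e
  starAt-spec v e = mk⇔ (dec-true⁻¹ (Incident? v e)) (dec-true (Incident? v e))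

  starAt-maximal : ∀ {v} → (∀ u → ¬ StarProperSub G v u) → IsMaximalStar G (starAt v)
  starAt-maximal max = _ , starAt-spec _ , max

  deg≥2⇒maximal : ∀ {v} → Deg≥2 v → ∀ u → ¬ StarProperSub G v u
  deg≥2⇒maximal {v} (g , h , g≢h , v∈g , v∈h) u (sub , e , u∈e , v∉e) with u ≟ v
  ... | yes refl = v∉e u∈e
  ... | no u≢v   = g≢h (samePair-unique (incident⇒samePair v∈g (sub g v∈g) (u≢v ∘ sym))
                                        (incident⇒samePair v∈h (sub h v∈h) (u≢v ∘ sym)))

  maximal-above : NoIsolated G → ∀ v → ∃[ w ] (StarSub G v w × (∀ u → ¬ StarProperSub G w u))
  maximal-above noIso v with noIso v
  ... | g , v∈g with deg≥2? v
  ... | yes deg = v , (λ _ v∈e → v∈e) , deg≥2⇒maximal deg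
  ... | no ¬deg with otherEnd v∈g
  ... | w , vw with deg≥2? w
  ... | yes degw = w , v⊆w , deg≥2⇒maximal degw
    where
    v⊆w : StarSub G v w
    v⊆w e v∈e = subst (Incident G w) (sym (¬deg≥2⇒unique ¬deg v∈g v∈e)) (proj₂ (samePair⇒incident vw))
  ... | no ¬degw = v , (λ _ v∈e → v∈e) , leaf-maximal
    where
    leaf-maximal : ∀ u → ¬ StarProperSub G v u
    leaf-maximal u (sub , e , u∈e , v∉e) with samePair-endpoint vw (sub g v∈g)
    ... | inj₁ refl = v∉e u∈e
    ... | inj₂ refl = v∉e (subst (Incident G v) (sym (¬deg≥2⇒unique ¬degw (proj₂ (samePair⇒incident vw)) u∈e)) v∈g)

  toggle-not-maximal : ∀ {F} e → IsMaximalStar G F → ¬ IsMaximalStar G (updateAt F e not)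
  toggle-not-maximal {F} e (w , F⇔w , max-w) (u , F′⇔u , max-u) with Incident? w e
  ... | yes w∈e = max-u w (u⊆w , e , w∈e , u∉e)
    where
    u∉e : ¬ Incident G u e
    u∉e u∈e = not-¬ (cong not (from (F⇔w e) w∈e)) (trans (sym (updateAt-updates e F)) (from (F′⇔u e) u∈e))
    u⊆w : StarSub G u w
    u⊆w j u∈j with j ≟ e
    ... | yes refl = w∈e
    ... | no j≢e   = to (F⇔w j) (trans (sym (updateAt-minimal j e F j≢e)) (from (F′⇔u j) u∈j))
  ... | no w∉e = max-w u (w⊆u , e , u∈e , w∉e)
    where
    u∈e : Incident G u e
    u∈e = to (F′⇔u e) (trans (updateAt-updates e F) (cong not (¬-not (w∉e ∘ to (F⇔w e)))))
    w⊆u : StarSub G w u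
    w⊆u j w∈j with j ≟ e
    ... | yes refl = u∈e
    ... | no j≢e   = to (F′⇔u j) (trans (updateAt-minimal j e F j≢e) (from (F⇔w j) w∈j))

module Bipartition (G : Graph) (bip : Bipartite G) where
  open Graph G
  open GraphFacts G

  colour : Vertex G → Bool
  colour = proj₁ bip

  samePair-colour : ∀ {e x y} → SamePair (ends e) (x , y) → colour y ≡ not (colour x)
  samePair-colour {e} (inj₁ (refl , refl)) = ¬-not (proj₂ bip e ∘ sym)
  samePair-colour {e} (inj₂ (refl , refl)) = ¬-not (proj₂ bip e)

  no-triangle : ∀ {a b c} → Adj G a b → Adj G b c → Adj G a c → ⊥
  no-triangle (_ , ab) (_ , bc) (_ , ac) = not-¬ c≡a (samePair-colour ac)
    where
    c≡a : colour _ ≡ colour _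
    c≡a = trans (samePair-colour bc) (trans (cong not (samePair-colour ab)) (not-involutive _))

  endOn : Bool → Edge G → Vertex G
  endOn c e = if does (colour (proj₁ (ends e)) Bool.≟ c) then proj₁ (ends e) else proj₂ (ends e)

  endOn-incident : ∀ c e → Incident G (endOn c e) e
  endOn-incident c e with colour (proj₁ (ends e)) Bool.≟ c
  ... | yes _ = inj₁ refl
  ... | no _  = inj₂ refl

  colour-endOn : ∀ c e → colour (endOn c e) ≡ c
  colour-endOn c e with colour (proj₁ (ends e)) Bool.≟ c
  ... | yes p≡c = p≡c
  ... | no p≢c  = trans (samePair-colour {e} (inj₁ (refl , refl)))
                    (trans (cong not (¬-not p≢c)) (not-involutive c))

  endOn-unique : ∀ {c v e} → Incident G v e → colour v ≡ c → endOn c e ≡ v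
  endOn-unique {c} {v} {e} v∈e refl with colour (proj₁ (ends e)) Bool.≟ colour v | v∈e
  ... | yes _   | inj₁ p≡v = p≡v
  ... | yes p~v | inj₂ refl = contradiction p~v (proj₂ bip e)
  ... | no p≁v  | inj₁ refl = contradiction refl p≁v
  ... | no _    | inj₂ q≡v = q≡v

  same-colour-endpoints : ∀ {x y e} → Incident G x e → Incident G y e → colour x ≡ colour y → x ≡ y
  same-colour-endpoints x∈e y∈e x∼y = trans (sym (endOn-unique x∈e refl)) (endOn-unique y∈e (sym x∼y))

  source-side : ∀ {c e u w} → SamePair (ends e) (u , w) → colour w ≢ c → colour u ≡ c
  source-side uw w≁c = not-injective (trans (sym (samePair-colour uw)) (¬-not w≁c))

  target-side : ∀ {c e u w} → SamePair (ends e) (u , w) → colour u ≡ c → colour w ≢ c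
  target-side uw refl w∼u = not-¬ w∼u (samePair-colour uw)

  starAt-on-side : ∀ {c v} → colour v ≡ c → ∀ e → starAt v e ≡ does (endOn c e ≟ v)
  starAt-on-side {c} {v} v∈c e =
    does-⇔ (mk⇔ (λ v∈e → endOn-unique v∈e v∈c) endOn≡⇒incident) (Incident? v e) (endOn c e ≟ v)
    where
    endOn≡⇒incident : endOn c e ≡ v → Incident G v e
    endOn≡⇒incident refl = endOn-incident c e

  endOn-samePair : ∀ c e → SamePair (ends e) (endOn c e , endOn (not c) e)
  endOn-samePair c e = incident⇒samePair (endOn-incident c e) (endOn-incident (not c) e) distinct
    where
    distinct : endOn c e ≢ endOn (not c) e
    distinct eq = not-¬ refl (trans (sym (colour-endOn c e)) (trans (cong colour eq) (colour-endOn (not c) e)))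

  ∑-by-endOn : ∀ c (P : Vertex G → Bool) (h : Edge G → ℚ) → (∀ v → P v ≡ true → colour v ≡ c) →
    sum (λ e → [ P (endOn c e) ]· h e) ≡ sum (λ v → [ P v ]· sum (λ e → [ starAt v e ]· h e))
  ∑-by-endOn c P h P⊆c = trans (∑-fibres (endOn c) P h) (∑-restrict-cong P λ v Pv →
    sum-cong-≗ λ e → cong (λ b → [ b ]· h e) (sym (starAt-on-side (P⊆c v Pv) e)))

  module _ (C : Edge G → Set) (C? : ∀ e → Dec (C e))
           (meet : ∀ {e f} → C e → C f → e ≢ f → ∃[ u ] (Incident G u e × Incident G u f)) where

    -- A pairwise intersecting family of edges is a star or a triangle, and bipartite graphs have no triangles.
    intersecting⇒common-vertex : ∀ {g} → C g → ∃[ c ] (Incident G c g × (∀ e → C e → Incident G c e))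
    intersecting⇒common-vertex {g} g∈C with any? (λ e → C? e ×-dec ¬? (Incident? (proj₁ (ends g)) e))
    ... | no none = _ , inj₁ refl , λ e e∈C → decidable-stable (Incident? _ e) (λ p∉e → none (e , e∈C , p∉e))
    ... | yes (k , k∈C , p∉k) = q , inj₂ refl , all-at-q
      where
      p q : Vertex G
      p = proj₁ (ends g)
      q = proj₂ (ends g)
      pq : SamePair (ends g) (p , q)
      pq = inj₁ (refl , refl)
      at-q-or-p : ∀ {e} → C e → ¬ Incident G q e → Incident G p e
      at-q-or-p {e} e∈C q∉e with meet g∈C e∈C (λ { refl → q∉e (inj₂ refl) })
      ... | u , u∈g , u∈e with samePair-endpoint pq u∈g
      ... | inj₁ refl = u∈e
      ... | inj₂ refl = contradiction u∈e q∉e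
      q∈k : Incident G q k
      q∈k = decidable-stable (Incident? q k) (p∉k ∘ at-q-or-p k∈C)
      all-at-q : ∀ e → C e → Incident G q e
      all-at-q e e∈C with Incident? q e
      ... | yes q∈e = q∈e
      ... | no q∉e with otherEnd q∈k | meet k∈C e∈C (λ { refl → q∉e q∈k })
      ... | r , qr | u , u∈k , u∈e with samePair-endpoint qr u∈k
      ... | inj₁ refl = contradiction u∈e q∉e
      ... | inj₂ refl = ⊥-elim (no-triangle (g , pq) (k , qr)
                          (e , incident⇒samePair (at-q-or-p e∈C q∉e) u∈e λ { refl → p∉k u∈k }))

  no-2-matching⇒star : NoIsolated G → ∀ v → ¬ (∃[ e ] ∃[ f ] Is2Matching G v e f) → CompIsStar G v
  no-2-matching⇒star noIso v no2 with noIso v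
  ... | g , v∈g with intersecting⇒common-vertex (CompEdge G v) (compEdge? v) meet (reach⇒compEdge here v∈g)
    where
    meet : ∀ {e f} → CompEdge G v e → CompEdge G v f → e ≢ f → ∃[ u ] (Incident G u e × Incident G u f)
    meet {e} {f} e∈ f∈ e≢f with meet-or-disjoint e f
    ... | inj₁ common   = common
    ... | inj₂ disjoint = contradiction (e , f , e∈ , f∈ , e≢f , disjoint) no2
  ... | c , c∈g , central with otherEnd c∈g
  ... | w , cw = c , reach-c , (w , reach-w , samePair-distinct cw ∘ sym) , adjacent , central
    where
    reach-c : Reach G v c
    reach-c = compEdge⇒reach (reach⇒compEdge here v∈g) c∈g
    reach-w : Reach G v w
    reach-w = compEdge⇒reach (reach⇒compEdge here v∈g) (proj₂ (samePair⇒incident cw))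
    adjacent : ∀ u → InComp G v u → u ≢ c → Adj G c u
    adjacent u r u≢c with noIso u
    ... | e , u∈e = e , incident⇒samePair (central e (reach⇒compEdge r u∈e)) u∈e (u≢c ∘ sym)

sumℚ≡sum : ∀ G k (f : Fin k → ℚ) → sumℚ G k f ≡ sum f
sumℚ≡sum G zero    f = refl
sumℚ≡sum G (suc k) f = cong (f zero +_) (sumℚ≡sum G k (f ∘ suc))

module StarWeights (G : Graph) (noIso : NoIsolated G) (φ : Edge G → ℚ) (φ≥0 : ∀ e → 0ℚ ≤ φ e)
                   (maximal⇔1 : ∀ F → IsMaximalStar G F ⇔ (weight G φ F ≡ 1ℚ)) where
  open Graph G
  open GraphFacts G

  W : EdgeSet G → ℚ
  W F = sum (λ e → [ F e ]· φ e)

  maximal⇒W≡1 : ∀ {F} → IsMaximalStar G F → W F ≡ 1ℚ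
  maximal⇒W≡1 {F} max = trans (sym (sumℚ≡sum G m _)) (to (maximal⇔1 F) max)

  W≡1⇒maximal : ∀ {F} → W F ≡ 1ℚ → IsMaximalStar G F
  W≡1⇒maximal {F} W≡1 = from (maximal⇔1 F) (trans (sumℚ≡sum G m _) W≡1)

  W-mono : ∀ {F F′} → (∀ e → F e ≡ true → F′ e ≡ true) → W F ≤ W F′
  W-mono {F} {F′} F⊆F′ = ∑-mono-≤ pointwise
    where
    pointwise : ∀ e → [ F e ]· φ e ≤ [ F′ e ]· φ e
    pointwise e with F e in Fe | F′ e in F′e
    ... | true  | true  = ℚ.≤-refl
    ... | true  | false = contradiction (trans (sym (F⊆F′ e Fe)) F′e) λ ()
    ... | false | true  = φ≥0 e
    ... | false | false = ℚ.≤-refl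

  W-toggle : ∀ F {e} → φ e ≡ 0ℚ → W (updateAt F e not) ≡ W F
  W-toggle F {e} φe≡0 = sum-cong-≗ pointwise
    where
    pointwise : ∀ j → [ updateAt F e not j ]· φ j ≡ [ F j ]· φ j
    pointwise j with j ≟ e
    ... | no j≢e  = cong (λ b → [ b ]· φ j) (updateAt-minimal j e F j≢e)
    ... | yes refl rewrite φe≡0 = trans ([]·-zero _) (sym ([]·-zero (F j)))

  W-pair : ∀ {T e f} → e ≢ f → T e ≡ true → T f ≡ true → φ e + φ f ≤ W T
  W-pair {T} {e} {f} e≢f Te Tf = begin
    φ e + φ f
      ≡⟨ cong₂ _+_ (∑-point φ e) (∑-point φ f) ⟨
    sum (λ j → [ does (j ≟ e) ]· φ j) + sum (λ j → [ does (j ≟ f) ]· φ j)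
      ≡⟨ ∑-distrib-+ (λ j → [ does (j ≟ e) ]· φ j) (λ j → [ does (j ≟ f) ]· φ j) ⟨
    sum (λ j → [ does (j ≟ e) ]· φ j + [ does (j ≟ f) ]· φ j)
      ≡⟨ sum-cong-≗ (λ j → []·-∨ _ _ (φ j) (disjoint j)) ⟨
    W (λ j → does (j ≟ e) ∨ does (j ≟ f))
      ≤⟨ W-mono pair⊆T ⟩
    W T ∎
    where
    open ℚ.≤-Reasoning
    disjoint : ∀ j → does (j ≟ e) ≡ true → does (j ≟ f) ≡ false
    disjoint j j≡e = dec-false (j ≟ f) (e≢f ∘ trans (sym (dec-true⁻¹ (j ≟ e) j≡e)))
    pair⊆T : ∀ j → does (j ≟ e) ∨ does (j ≟ f) ≡ true → T j ≡ true
    pair⊆T j _ with j ≟ e | j ≟ f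
    ... | yes refl | _        = Te
    ... | no _     | yes refl = Tf

  starWeight : Vertex G → ℚ
  starWeight v = W (starAt v)

  starWeight-deg≥2 : ∀ {v} → Deg≥2 v → starWeight v ≡ 1ℚ
  starWeight-deg≥2 deg = maximal⇒W≡1 (starAt-maximal (deg≥2⇒maximal deg))

  starWeight-leaf : ∀ {v e} → ¬ Deg≥2 v → Incident G v e → starWeight v ≡ φ e
  starWeight-leaf {v} {e} ¬deg v∈e = trans (sum-cong-≗ only-e) (∑-point φ e)
    where
    only-e : ∀ j → [ starAt v j ]· φ j ≡ [ does (j ≟ e) ]· φ j
    only-e j = cong (λ b → [ b ]· φ j)
      (does-⇔ (mk⇔ (¬deg≥2⇒unique ¬deg v∈e) λ { refl → v∈e }) (Incident? v j) (j ≟ e))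

  starWeight≤1 : ∀ v → starWeight v ≤ 1ℚ
  starWeight≤1 v with maximal-above noIso v
  ... | w , v⊆w , max = ℚ.≤-trans (W-mono E[v]⊆E[w]) (ℚ.≤-reflexive (maximal⇒W≡1 (starAt-maximal max)))
    where
    E[v]⊆E[w] : ∀ e → starAt v e ≡ true → starAt w e ≡ true
    E[v]⊆E[w] e = from (starAt-spec w e) ∘ v⊆w e ∘ to (starAt-spec v e)

  φ-positive : ∀ e → 0ℚ < φ e
  φ-positive e with ℚ.<-cmp 0ℚ (φ e)
  ... | tri< 0<φe _ _ = 0<φe
  ... | tri> _ _ φe<0 = ⊥-elim (ℚ.<-irrefl refl (ℚ.≤-<-trans (φ≥0 e) φe<0))
  ... | tri≈ _ 0≡φe _ with maximal-above noIso (proj₁ (ends e))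
  ... | w , _ , max = ⊥-elim (toggle-not-maximal e E[w]-maximal
                        (W≡1⇒maximal (trans (W-toggle (starAt w) (sym 0≡φe)) (maximal⇒W≡1 E[w]-maximal))))
    where
    E[w]-maximal : IsMaximalStar G (starAt w)
    E[w]-maximal = starAt-maximal max

  -- If b (or d) is a leaf, its star is {e} (or {f}) and the weights overshoot; otherwise W T = 1,
  -- so T is a star containing two disjoint edges.
  disjoint-pair-no-excess : ∀ {T b d e f} → Incident G b e → Incident G d f →
    (∀ u → Incident G u e → ¬ Incident G u f) → T e ≡ true → T f ≡ true →
    starWeight b + starWeight d ≢ 1ℚ + W T
  disjoint-pair-no-excess {T} {b} {d} {e} {f} b∈e d∈f disjoint Te Tf excess with deg≥2? b | deg≥2? d
  ... | no ¬deg-b | _ =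
    overshoot-absurd (φ e) (starWeight d) (φ f) (W T)
      (trans (cong (_+ starWeight d) (sym (starWeight-leaf ¬deg-b b∈e))) excess)
      (W-pair e≢f Te Tf) (starWeight≤1 d) (φ-positive f)
    where
    e≢f : e ≢ f
    e≢f refl = disjoint b b∈e b∈e
  ... | yes _ | no ¬deg-d =
    overshoot-absurd (φ f) (starWeight b) (φ e) (W T)
      (trans (ℚ.+-comm (φ f) _) (trans (cong (starWeight b +_) (sym (starWeight-leaf ¬deg-d d∈f))) excess))
      (W-pair f≢e Tf Te) (starWeight≤1 b) (φ-positive e)
    where
    f≢e : f ≢ e
    f≢e refl = disjoint d d∈f d∈f
  ... | yes deg-b | yes deg-d with W≡1⇒maximal {T} (sym (∙-cancelˡ 1ℚ 1ℚ (W T) two≡1+WT))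
    where
    two≡1+WT : 1ℚ + 1ℚ ≡ 1ℚ + W T
    two≡1+WT = trans (sym (cong₂ _+_ (starWeight-deg≥2 deg-b) (starWeight-deg≥2 deg-d))) excess
  ... | w , T⇔w , _ = disjoint w (to (T⇔w e) Te) (to (T⇔w f) Tf)

module Matchings (G : Graph) (Usable : Edge G → Set) where
  open Graph G
  open GraphFacts G

  IsMatching : EdgeSet G → Set
  IsMatching M = ∀ {g h u} → M g ≡ true → M h ≡ true → Incident G u g → Incident G u h → g ≡ h

  record Matching : Set where
    field
      edges      : EdgeSet G
      isMatching : IsMatching edges
      usable     : ∀ {g} → edges g ≡ true → Usable g

  open Matching public

  _covers_ : Matching → Vertex G → Set
  M covers u = Covered G (edges M) u

  covered-⊆ : ∀ {M M′ : EdgeSet G} → (∀ {j} → M j ≡ true → M′ j ≡ true) →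
              ∀ {u} → Covered G M u → Covered G M′ u
  covered-⊆ M⊆M′ (j , Mj , u∈j) = j , M⊆M′ Mj , u∈j

  covered-degree : ∀ {M} → IsMatching M → ∀ {v} → Covered G M v →
                   sum (λ e → [ starAt v e ]· [ M e ]· 1ℚ) ≡ 1ℚ
  covered-degree {M} matching {v} (j , Mj , v∈j) = trans (∑-single _ j others) at-j
    where
    others : ∀ e → e ≢ j → [ starAt v e ]· [ M e ]· 1ℚ ≡ 0ℚ
    others e e≢j with starAt v e in ve | M e in Me
    ... | false | _     = refl
    ... | true  | false = refl
    ... | true  | true  = contradiction (matching Me Mj (to (starAt-spec v e) ve) v∈j) e≢j
    at-j : [ starAt v j ]· [ M j ]· 1ℚ ≡ 1ℚ
    at-j rewrite from (starAt-spec v j) v∈j | Mj = refl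

  ∅ : Matching
  ∅ = record { edges = λ _ → false ; isMatching = λ () ; usable = λ () }

  insertEdge deleteEdge : Edge G → EdgeSet G → EdgeSet G
  insertEdge g M = updateAt M g (const true)
  deleteEdge h M = updateAt M h (const false)

  insertEdge-member : ∀ g M {j} → insertEdge g M j ≡ true → j ≡ g ⊎ M j ≡ true
  insertEdge-member g M {j} M′j with j ≟ g
  ... | yes j≡g = inj₁ j≡g
  ... | no j≢g  = inj₂ (trans (sym (updateAt-minimal j g M j≢g)) M′j)

  insertEdge-⊇ : ∀ g M {j} → M j ≡ true → insertEdge g M j ≡ true
  insertEdge-⊇ g M {j} Mj with j ≟ g
  ... | yes refl = updateAt-updates g M
  ... | no j≢g   = trans (updateAt-minimal j g M j≢g) Mj

  deleteEdge-member : ∀ h M {j} → deleteEdge h M j ≡ true → j ≢ h × M j ≡ true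
  deleteEdge-member h M {j} M′j with j ≟ h
  ... | yes refl = contradiction (trans (sym (updateAt-updates h M)) M′j) λ ()
  ... | no j≢h   = j≢h , trans (sym (updateAt-minimal j h M j≢h)) M′j

  deleteEdge-⊇ : ∀ h M {j} → M j ≡ true → j ≢ h → deleteEdge h M j ≡ true
  deleteEdge-⊇ h M {j} Mj j≢h = trans (updateAt-minimal j h M j≢h) Mj

  covered-insertEdge-end : ∀ g M {u} → Incident G u g → Covered G (insertEdge g M) u
  covered-insertEdge-end g M u∈g = g , updateAt-updates g M , u∈g

  covered-insertEdge⁻ : ∀ g M {u} → Covered G (insertEdge g M) u → Incident G u g ⊎ Covered G M u
  covered-insertEdge⁻ g M (j , M′j , u∈j) with insertEdge-member g M M′j
  ... | inj₁ refl = inj₁ u∈j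
  ... | inj₂ Mj   = inj₂ (j , Mj , u∈j)

  covered-deleteEdge : ∀ h M {u} → Covered G M u → Covered G (deleteEdge h M) u ⊎ Incident G u h
  covered-deleteEdge h M (j , Mj , u∈j) with j ≟ h
  ... | yes refl = inj₂ u∈j
  ... | no j≢h   = inj₁ (j , deleteEdge-⊇ h M Mj j≢h , u∈j)

  isMatching-⊆ : ∀ {M M′} → IsMatching M → (∀ {j} → M′ j ≡ true → M j ≡ true) → IsMatching M′
  isMatching-⊆ matching M′⊆M M′j M′k = matching (M′⊆M M′j) (M′⊆M M′k)

  insertEdge-isMatching : ∀ g {M} → IsMatching M → (∀ {u} → Incident G u g → ¬ Covered G M u) →
                          IsMatching (insertEdge g M)
  insertEdge-isMatching g {M} matching free {j} {k} M′j M′k u∈j u∈k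
    with insertEdge-member g M M′j | insertEdge-member g M M′k
  ... | inj₁ refl | inj₁ refl = refl
  ... | inj₁ refl | inj₂ Mk   = contradiction (k , Mk , u∈k) (free u∈j)
  ... | inj₂ Mj   | inj₁ refl = contradiction (j , Mj , u∈j) (free u∈k)
  ... | inj₂ Mj   | inj₂ Mk   = matching Mj Mk u∈j u∈k

  insert : (M : Matching) (g : Edge G) → Usable g → (∀ {u} → Incident G u g → ¬ M covers u) → Matching
  insert M g usable-g free = record
    { edges      = insertEdge g (edges M)
    ; isMatching = insertEdge-isMatching g (isMatching M) free
    ; usable     = λ M′j → [ (λ { refl → usable-g }) , usable M ]′ (insertEdge-member g (edges M) M′j)
    }

  delete : Matching → Edge G → Matching
  delete M h = record
    { edges      = deleteEdge h (edges M)
    ; isMatching = isMatching-⊆ (isMatching M) ⊆M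
    ; usable     = usable M ∘ ⊆M
    }
    where
    ⊆M : ∀ {j} → deleteEdge h (edges M) j ≡ true → edges M j ≡ true
    ⊆M = proj₂ ∘ deleteEdge-member h (edges M)

  delete-uncovers : ∀ M {h u} → edges M h ≡ true → Incident G u h → ¬ (delete M h covers u)
  delete-uncovers M {h} Mh u∈h (j , M′j , u∈j) with deleteEdge-member h (edges M) M′j
  ... | j≢h , Mj = j≢h (isMatching M Mj Mh u∈j u∈h)

  delete-covers⁻ : ∀ M h {u} → delete M h covers u → M covers u
  delete-covers⁻ M h = covered-⊆ (proj₂ ∘ deleteEdge-member h (edges M))

module BipartiteMatchings (G : Graph) (bip : Bipartite G) (Usable : Edge G → Set) where
  open Graph G
  open GraphFacts G
  open Bipartition G bip
  open Matchings G Usable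
  open Walks using (start; _▷_)

  Permitted : EdgeSet G → Bool → Vertex G → Edge G → Set
  Permitted M c u g = (colour u ≡ c × Usable g) ⊎ (colour u ≢ c × M g ≡ true)

  near-step-usable : ∀ {M c u g} → colour u ≡ c → Permitted M c u g → Usable g
  near-step-usable _   (inj₁ (_ , usable-g)) = usable-g
  near-step-usable u∼c (inj₂ (u≁c , _))     = contradiction u∼c u≁c

  far-step-matched : ∀ {M c u g} → colour u ≢ c → Permitted M c u g → M g ≡ true
  far-step-matched u≁c (inj₁ (u∼c , _)) = contradiction u∼c u≁c
  far-step-matched _   (inj₂ (_ , Mg))  = Mg

  permitted⇒usable : ∀ (M : Matching) {c u g} → Permitted (edges M) c u g → Usable g
  permitted⇒usable M = [ proj₂ , usable M ∘ proj₂ ]′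

  count-via-matching : ∀ {M} c (P Q : Vertex G → Bool) → IsMatching M →
    (∀ v → P v ≡ true → colour v ≡ c × Covered G M v) →
    (∀ v → Q v ≡ true → colour v ≡ not c × Covered G M v) →
    (∀ e → M e ≡ true → P (endOn c e) ≡ Q (endOn (not c) e)) → count P ≡ count Q
  count-via-matching {M} c P Q matching P⊆ Q⊆ P↔Q = begin
    count P                                             ≡⟨ ∑-restrict-cong P (λ v → sym ∘ degree-one ∘ proj₂ ∘ P⊆ v) ⟩
    sum (λ v → [ P v ]· degree v)                       ≡⟨ ∑-by-endOn c P _ (λ v → proj₁ ∘ P⊆ v) ⟨
    sum (λ e → [ P (endOn c e) ]· [ M e ]· 1ℚ)          ≡⟨ sum-cong-≗ across ⟩
    sum (λ e → [ Q (endOn (not c) e) ]· [ M e ]· 1ℚ)    ≡⟨ ∑-by-endOn (not c) Q _ (λ v → proj₁ ∘ Q⊆ v) ⟩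
    sum (λ v → [ Q v ]· degree v)                       ≡⟨ ∑-restrict-cong Q (λ v → degree-one ∘ proj₂ ∘ Q⊆ v) ⟩
    count Q                                             ∎
    where
    open ≡-Reasoning
    degree : Vertex G → ℚ
    degree v = sum (λ e → [ starAt v e ]· [ M e ]· 1ℚ)
    degree-one : ∀ {v} → Covered G M v → degree v ≡ 1ℚ
    degree-one = covered-degree matching
    across : ∀ e → [ P (endOn c e) ]· [ M e ]· 1ℚ ≡ [ Q (endOn (not c) e) ]· [ M e ]· 1ℚ
    across e with M e in Me
    ... | true  = cong (λ b → [ b ]· 1ℚ) (P↔Q e Me)
    ... | false = trans ([]·-zero _) (sym ([]·-zero _))

  AltStep : EdgeSet G → Bool → Vertex G → Vertex G → Set
  AltStep M c u w = ∃[ g ] (SamePair (ends g) (u , w) × Permitted M c u g)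

  AltWalk : EdgeSet G → Vertex G → Vertex G → Set
  AltWalk M s = Walks.Walk (AltStep M (colour s)) s

  altLength : ∀ {M s w} → AltWalk M s w → ℕ
  altLength = Walks.length _

  Transported : EdgeSet G → Vertex G → Vertex G → ℕ → Set
  Transported M s w n = Σ (AltWalk M s w) λ p → altLength p ≡ n

  Shortcut : EdgeSet G → Vertex G → Edge G → ℕ → Set
  Shortcut M s h n = ∃[ x ] (Incident G x h × colour x ≡ colour s × Σ (AltWalk M s x) λ r → altLength r ≤ℕ n)

  -- A matching edge is only traversed towards its endpoint on the root's side, so a walk that
  -- used h has a prefix ending there.
  transport : ∀ {M M′ h s w} → (∀ {j} → M j ≡ true → j ≢ h → M′ j ≡ true) → (p : AltWalk M s w) →
              Transported M′ s w (altLength p) ⊎ Shortcut M s h (altLength p)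
  transport keep start = inj₁ (start , refl)
  transport {h = h} keep (p ▷ (j , uw , ok)) with transport keep p
  ... | inj₂ (x , x∈h , x∼s , r , |r|≤|p|) = inj₂ (x , x∈h , x∼s , r , ℕ.m≤n⇒m≤1+n |r|≤|p|)
  ... | inj₁ (p′ , same) with ok
  ... | inj₁ usable-j = inj₁ (p′ ▷ (j , uw , inj₁ usable-j) , cong suc same)
  ... | inj₂ (u≁s , Mj) with j ≟ h
  ... | no j≢h   = inj₁ (p′ ▷ (j , uw , inj₂ (u≁s , keep Mj j≢h)) , cong suc same)
  ... | yes refl = inj₂ (_ , proj₂ (samePair⇒incident uw) , source-side (samePair-swap uw) u≁s ,
                         p ▷ (j , uw , ok) , ℕ.≤-refl)

  module Shift (M : Matching) {h g x y y′} (Mh : edges M h ≡ true) (y′x : SamePair (ends h) (y′ , x))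
               (xy : SamePair (ends g) (x , y)) (usable-g : Usable g) (y-free : ¬ M covers y) where

    private
      free : ∀ {u} → Incident G u g → ¬ delete M h covers u
      free u∈g with samePair-endpoint xy u∈g
      ... | inj₁ refl = delete-uncovers M Mh (proj₂ (samePair⇒incident y′x))
      ... | inj₂ refl = y-free ∘ delete-covers⁻ M h

    shifted : Matching
    shifted = insert (delete M h) g usable-g free

    keeps-edges : ∀ {j} → edges M j ≡ true → j ≢ h → edges shifted j ≡ true
    keeps-edges Mj j≢h = insertEdge-⊇ g (edges (delete M h)) (deleteEdge-⊇ h (edges M) Mj j≢h)

    keeps : ∀ {u} → M covers u → shifted covers u ⊎ u ≡ y′
    keeps c with covered-deleteEdge h (edges M) c
    ... | inj₁ c′ = inj₁ (covered-⊆ (insertEdge-⊇ g (edges (delete M h))) c′)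
    ... | inj₂ u∈h with samePair-endpoint y′x u∈h
    ... | inj₁ u≡y′ = inj₂ u≡y′
    ... | inj₂ refl = inj₁ (covered-insertEdge-end g (edges (delete M h)) (proj₁ (samePair⇒incident xy)))

    covers-y : shifted covers y
    covers-y = covered-insertEdge-end g (edges (delete M h)) (proj₂ (samePair⇒incident xy))

    keeps-free : ∀ {u} → ¬ M covers u → u ≢ y → ¬ shifted covers u
    keeps-free u-free u≢y c with covered-insertEdge⁻ g (edges (delete M h)) c
    ... | inj₂ c′ = u-free (delete-covers⁻ M h c′)
    ... | inj₁ u∈g with samePair-endpoint xy u∈g
    ... | inj₁ refl = u-free (h , Mh , proj₂ (samePair⇒incident y′x))
    ... | inj₂ refl = u≢y refl

    frees-y′ : ¬ shifted covers y′
    frees-y′ c with covered-insertEdge⁻ g (edges (delete M h)) c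
    ... | inj₂ c′ = delete-uncovers M Mh (proj₁ (samePair⇒incident y′x)) c′
    ... | inj₁ y′∈g with samePair-endpoint xy y′∈g
    ... | inj₁ refl = samePair-distinct y′x refl
    ... | inj₂ refl = y-free (h , Mh , proj₁ (samePair⇒incident y′x))

  Augmentation : Matching → Vertex G → Vertex G → Set
  Augmentation M s y = ∃[ M′ ] ((∀ {u} → M covers u → M′ covers u) × M′ covers s × M′ covers y)

  augment : ∀ k (M : Matching) {s y} → ¬ M covers s → (p : AltWalk (edges M) s y) → altLength p ≤ℕ k →
            colour y ≢ colour s → ¬ M covers y → Augmentation M s y
  augment _ M s-free start _ s≁s _ = contradiction refl s≁s
  augment zero M s-free (_ ▷ _) () _ _
  augment (suc k) M s-free (start ▷ (g , sy , ok)) _ _ y-free =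
    insert M g (near-step-usable {edges M} refl ok) free ,
    covered-⊆ (insertEdge-⊇ g (edges M)) ,
    covered-insertEdge-end g (edges M) (proj₁ (samePair⇒incident sy)) ,
    covered-insertEdge-end g (edges M) (proj₂ (samePair⇒incident sy))
    where
    free : ∀ {u} → Incident G u g → ¬ M covers u
    free u∈g with samePair-endpoint sy u∈g
    ... | inj₁ refl = s-free
    ... | inj₂ refl = y-free
  augment (suc k) M {s} {y} s-free (q ▷ (h , y′x , ok′) ▷ (g , xy , ok)) (s≤s |q|<k) y≁s y-free =
    [ along , shortcut ]′ (transport keeps-edges q)
    where
    x∼s : colour _ ≡ colour s
    x∼s = source-side xy y≁s
    y′≁s : colour _ ≢ colour s
    y′≁s = target-side (samePair-swap y′x) x∼s
    open Shift M (far-step-matched {edges M} y′≁s ok′) y′x xy (near-step-usable {edges M} x∼s ok) y-free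
    along : Transported (edges shifted) s _ (altLength q) → Augmentation M s y
    along (q′ , same) with augment k shifted (keeps-free s-free (y≁s ∘ cong colour ∘ sym)) q′
                             (subst (_≤ℕ k) (sym same) (ℕ.<⇒≤ |q|<k)) y′≁s frees-y′
    ... | M′ , grows , covers-s , covers-y′ =
      M′ , [ grows , (λ { refl → covers-y′ }) ]′ ∘ keeps , covers-s , grows covers-y
    shortcut : Shortcut (edges M) s h (altLength q) → Augmentation M s y
    shortcut (x′ , x′∈h , x′∼s , r , |r|≤|q|)
      with same-colour-endpoints x′∈h (proj₂ (samePair⇒incident y′x)) (trans x′∼s (sym x∼s))
    ... | refl = augment k M s-free (r ▷ (g , xy , ok)) (ℕ.≤-<-trans |r|≤|q| |q|<k) y≁s y-free

  Release : Matching → Vertex G → Vertex G → Set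
  Release M s x = ∃[ M′ ] ((∀ {u} → u ≢ x → M covers u → M′ covers u) × M′ covers s)

  -- Unmatch x and augment from its former partner instead.
  release : ∀ k (M : Matching) {s x} → ¬ M covers s → (q : AltWalk (edges M) s x) → altLength q ≤ℕ k →
            colour x ≡ colour s → x ≢ s → Release M s x
  release _ M s-free start _ _ s≢s = contradiction refl s≢s
  release zero M s-free (_ ▷ _) () _ _
  release (suc k) M {s} {x} s-free (q ▷ (h , y′x , ok′)) (s≤s |q|≤k) x∼s x≢s =
    [ along , shortcut ]′ (transport (deleteEdge-⊇ h (edges M)) q)
    where
    y′≁s : colour _ ≢ colour s
    y′≁s = target-side (samePair-swap y′x) x∼s
    Mh : edges M h ≡ true
    Mh = far-step-matched {edges M} y′≁s ok′
    along : Transported (edges (delete M h)) s _ (altLength q) → Release M s x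
    along (q′ , _) with augment (altLength q′) (delete M h) (s-free ∘ delete-covers⁻ M h) q′ ℕ.≤-refl y′≁s
                          (delete-uncovers M Mh (proj₁ (samePair⇒incident y′x)))
    ... | M′ , grows , covers-s , covers-y′ = M′ , grows′ , covers-s
      where
      grows′ : ∀ {u} → u ≢ x → M covers u → M′ covers u
      grows′ u≢x c with covered-deleteEdge h (edges M) c
      ... | inj₁ c′ = grows c′
      ... | inj₂ u∈h with samePair-endpoint y′x u∈h
      ... | inj₁ refl = covers-y′
      ... | inj₂ refl = contradiction refl u≢x
    shortcut : Shortcut (edges M) s h (altLength q) → Release M s x
    shortcut (x′ , x′∈h , x′∼s , r , |r|≤|q|)
      with same-colour-endpoints x′∈h (proj₂ (samePair⇒incident y′x)) (trans x′∼s (sym x∼s))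
    ... | refl = release k M s-free r (ℕ.≤-trans |r|≤|q| |q|≤k) x∼s x≢s

module Covering (G : Graph) (bip : Bipartite G) (noIso : NoIsolated G) (φ : Edge G → ℚ)
                (φ≥0 : ∀ e → 0ℚ ≤ φ e) (maximal⇔1 : ∀ F → IsMaximalStar G F ⇔ (weight G φ F ≡ 1ℚ)) where
  open Graph G
  open GraphFacts G
  open Bipartition G bip
  open StarWeights G noIso φ φ≥0 maximal⇔1

  ∑-endOn-deg≥2 : ∀ c (P : Vertex G → Bool) → (∀ v → P v ≡ true → colour v ≡ c × Deg≥2 v) →
                  sum (λ e → [ P (endOn c e) ]· φ e) ≡ count P
  ∑-endOn-deg≥2 c P P⊆ = trans (∑-by-endOn c P φ (λ v → proj₁ ∘ P⊆ v))
                                (∑-restrict-cong P (λ v → starWeight-deg≥2 ∘ proj₂ ∘ P⊆ v))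

  module AvoidingPair {e₀ f₀ : Edge G} (disjoint : ∀ u → Incident G u e₀ → ¬ Incident G u f₀) where

    Blocked : Vertex G → Set
    Blocked u = Incident G u e₀ ⊎ Incident G u f₀

    Usable : Edge G → Set
    Usable g = ∀ u → Incident G u g → ¬ Blocked u

    Needy : Vertex G → Set
    Needy u = Deg≥2 u × ¬ Blocked u

    blocked? : ∀ u → Dec (Blocked u)
    blocked? u = Incident? u e₀ ⊎-dec Incident? u f₀

    needy? : ∀ u → Dec (Needy u)
    needy? u = deg≥2? u ×-dec ¬? (blocked? u)

    open Matchings G Usable
    open BipartiteMatchings G bip Usable

    covers? : ∀ M u → Dec (M covers u)
    covers? M u = any? (λ j → (edges M j Bool.≟ true) ×-dec Incident? u j)

    altWalk? : ∀ M s w → Dec (AltWalk (edges M) s w)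
    altWalk? M s = Walks.walk? (AltStep (edges M) (colour s)) altStep? s
      where
      usable? : ∀ g → Dec (Usable g)
      usable? g = all? (λ u → Incident? u g →-dec ¬? (blocked? u))
      altStep? : ∀ u w → Dec (AltStep (edges M) (colour s) u w)
      altStep? u w = any? λ g → samePair? (ends g) (u , w) ×-dec
        (((colour u Bool.≟ colour s) ×-dec usable? g) ⊎-dec (¬? (colour u Bool.≟ colour s) ×-dec (edges M g Bool.≟ true)))

    module Stuck (M : Matching) {s} (needy-s : Needy s) (s-free : ¬ M covers s)
      (no-free  : ¬ (∃[ y ] (AltWalk (edges M) s y × colour y ≢ colour s × ¬ M covers y)))
      (no-spare : ¬ (∃[ x ] (AltWalk (edges M) s x × colour x ≡ colour s × x ≢ s × ¬ Needy x))) where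

      c : Bool
      c = colour s

      open Walks using (start; _▷_)

      reachable-unblocked : ∀ {w} → AltWalk (edges M) s w → ¬ Blocked w
      reachable-unblocked start                = proj₂ needy-s
      reachable-unblocked (_ ▷ (g , uw , ok)) = permitted⇒usable M ok _ (proj₂ (samePair⇒incident uw))

      near-deg≥2 : ∀ {x} → AltWalk (edges M) s x → colour x ≡ c → Deg≥2 x
      near-deg≥2 {x} p x∼c with x ≟ s
      ... | yes refl = proj₁ needy-s
      ... | no x≢s   = proj₁ (decidable-stable (needy? x) λ ¬needy → no-spare (x , p , x∼c , x≢s , ¬needy))

      near-covered : ∀ {x} → AltWalk (edges M) s x → colour x ≡ c → x ≢ s → M covers x
      near-covered start _ s≢s = contradiction refl s≢s
      near-covered (_ ▷ (h , y′x , ok)) x∼c _ =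
        h , far-step-matched {edges M} (target-side (samePair-swap y′x) x∼c) ok , proj₂ (samePair⇒incident y′x)

      far-covered : ∀ {y} → AltWalk (edges M) s y → colour y ≢ c → M covers y
      far-covered {y} p y≁c = decidable-stable (covers? M y) λ y-free → no-free (y , p , y≁c , y-free)

      -- If y was entered through its own matching edge g, the walk reached the other end of g
      -- through g as well, hence passed y earlier.
      far-deg≥2 : ∀ {y} → AltWalk (edges M) s y → colour y ≢ c → M covers y → Deg≥2 y
      far-deg≥2 start s≁s _ = contradiction refl s≁s
      far-deg≥2 {y} (p ▷ (g , xy , ok)) y≁c (h , Mh , y∈h) with g ≟ h
      ... | no g≢h   = g , h , g≢h , proj₂ (samePair⇒incident xy) , y∈h
      ... | yes refl = earlier p
        where
        x∈g : Incident G _ g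
        x∈g = proj₁ (samePair⇒incident xy)
        earlier : AltWalk (edges M) s _ → Deg≥2 y
        earlier start = ⊥-elim (s-free (g , Mh , x∈g))
        earlier (p′ ▷ (h′ , y′x , ok′)) with samePair-endpoint xy (subst (Incident G _) h′≡g y′∈h′)
          where
          y′∈h′ : Incident G _ h′
          y′∈h′ = proj₁ (samePair⇒incident y′x)
          h′≡g : h′ ≡ g
          h′≡g = isMatching M (far-step-matched {edges M} (target-side (samePair-swap y′x) (source-side xy y≁c)) ok′)
                   Mh (proj₂ (samePair⇒incident y′x)) x∈g
        ... | inj₁ y′≡x = ⊥-elim (samePair-distinct y′x y′≡x)
        ... | inj₂ refl = far-deg≥2 p′ y≁c (g , Mh , y∈h)

      Near Far : Vertex G → Set
      Near v = AltWalk (edges M) s v × colour v ≡ c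
      Far v  = AltWalk (edges M) s v × colour v ≢ c

      near? : ∀ v → Dec (Near v)
      near? v = altWalk? M s v ×-dec (colour v Bool.≟ c)

      far? : ∀ v → Dec (Far v)
      far? v = altWalk? M s v ×-dec ¬? (colour v Bool.≟ c)

      inNear inNear′ inFar : Vertex G → Bool
      inNear v  = does (near? v)
      inNear′ v = does (near? v ×-dec ¬? (v ≟ s))
      inFar v   = does (far? v)

      b d : Vertex G
      b = endOn (not c) e₀
      d = endOn (not c) f₀

      inFar⁺ : Vertex G → Bool
      inFar⁺ v = inFar v ∨ (does (v ≟ b) ∨ does (v ≟ d))

      matched-partner-far : ∀ {x e} → AltWalk (edges M) s x → colour x ≡ c → x ≢ s →
                            edges M e ≡ true → Incident G x e → Far (endOn (not c) e)
      matched-partner-far start _ s≢s = contradiction refl s≢s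
      matched-partner-far {e = e} (r ▷ (h , y′x , ok)) x∼c _ Me x∈e = subst Far y′≡β (r , y′≁c)
        where
        y′≁c : colour _ ≢ c
        y′≁c = target-side (samePair-swap y′x) x∼c
        h≡e : h ≡ e
        h≡e = isMatching M (far-step-matched {edges M} y′≁c ok) Me (proj₂ (samePair⇒incident y′x)) x∈e
        y′≡β : _ ≡ endOn (not c) e
        y′≡β = sym (endOn-unique (subst (Incident G _) h≡e (proj₁ (samePair⇒incident y′x))) (¬-not y′≁c))

      matched-near′⇔far : ∀ e → edges M e ≡ true → inNear′ (endOn c e) ≡ inFar (endOn (not c) e)
      matched-near′⇔far e Me = does-⇔ (mk⇔ to′ from′) (near? _ ×-dec ¬? (_ ≟ s)) (far? _)
        where
        to′ : Near (endOn c e) × endOn c e ≢ s → Far (endOn (not c) e)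
        to′ ((p , α∼c) , α≢s) = matched-partner-far p α∼c α≢s Me (endOn-incident c e)
        from′ : Far (endOn (not c) e) → Near (endOn c e) × endOn c e ≢ s
        from′ (p , β≁c) = (p ▷ (e , samePair-swap (endOn-samePair c e) , inj₂ (β≁c , Me)) , colour-endOn c e) ,
                          λ α≡s → s-free (e , Me , subst (λ v → Incident G v e) α≡s (endOn-incident c e))

      count-near : count inNear ≡ 1ℚ + count inFar
      count-near = trans (∑-split-point inNear (λ _ → 1ℚ) (dec-true (near? s) (start , refl)))
                         (cong (1ℚ +_) (count-via-matching c inNear′ inFar (isMatching M) near′⊆ far⊆ matched-near′⇔far))
        where
        near′⊆ : ∀ v → inNear′ v ≡ true → colour v ≡ c × M covers v
        near′⊆ v eq with dec-true⁻¹ (near? v ×-dec ¬? (v ≟ s)) eq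
        ... | (p , v∼c) , v≢s = v∼c , near-covered p v∼c v≢s
        far⊆ : ∀ v → inFar v ≡ true → colour v ≡ not c × M covers v
        far⊆ v eq with dec-true⁻¹ (far? v) eq
        ... | p , v≁c = ¬-not v≁c , far-covered p v≁c

      ∑-near : sum (λ e → [ inNear (endOn c e) ]· φ e) ≡ count inNear
      ∑-near = ∑-endOn-deg≥2 c inNear near⊆
        where
        near⊆ : ∀ v → inNear v ≡ true → colour v ≡ c × Deg≥2 v
        near⊆ v eq with dec-true⁻¹ (near? v) eq
        ... | p , v∼c = v∼c , near-deg≥2 p v∼c

      ∑-far : sum (λ e → [ inFar (endOn (not c) e) ]· φ e) ≡ count inFar
      ∑-far = ∑-endOn-deg≥2 (not c) inFar far⊆
        where
        far⊆ : ∀ v → inFar v ≡ true → colour v ≡ not c × Deg≥2 v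
        far⊆ v eq with dec-true⁻¹ (far? v) eq
        ... | p , v≁c = ¬-not v≁c , far-deg≥2 p v≁c (far-covered p v≁c)

      -- stated with inFar⁺ unfolded, so that rewrite can reach the disjuncts
      far⁺-intro : ∀ {v} → Far v ⊎ v ≡ b ⊎ v ≡ d → does (far? v) ∨ (does (v ≟ b) ∨ does (v ≟ d)) ≡ true
      far⁺-intro {v} (inj₁ far) rewrite dec-true (far? v) far = refl
      far⁺-intro {v} (inj₂ (inj₁ refl)) rewrite dec-true (v ≟ v) refl = ∨-zeroʳ _
      far⁺-intro {v} (inj₂ (inj₂ refl)) rewrite dec-true (v ≟ v) refl | ∨-zeroʳ (does (v ≟ b)) = ∨-zeroʳ _

      far⁺-split : ∀ v x → [ inFar⁺ v ]· x ≡ [ inFar v ]· x + ([ does (v ≟ b) ]· x + [ does (v ≟ d) ]· x)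
      far⁺-split v x = trans ([]·-∨ (inFar v) _ x far∌bd) (cong ([ inFar v ]· x +_) ([]·-∨ _ _ x b≢d))
        where
        far∌bd : inFar v ≡ true → does (v ≟ b) ∨ does (v ≟ d) ≡ false
        far∌bd eq with dec-true⁻¹ (far? v) eq
        ... | p , _ rewrite dec-false (v ≟ b) (λ { refl → reachable-unblocked p (inj₁ (endOn-incident (not c) e₀)) })
                          | dec-false (v ≟ d) (λ { refl → reachable-unblocked p (inj₂ (endOn-incident (not c) f₀)) }) = refl
        b≢d : does (v ≟ b) ≡ true → does (v ≟ d) ≡ false
        b≢d eq with dec-true⁻¹ (v ≟ b) eq
        ... | refl = dec-false (b ≟ d) λ b≡d →
          disjoint b (endOn-incident (not c) e₀) (subst (λ u → Incident G u f₀) (sym b≡d) (endOn-incident (not c) f₀))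

      starWeight-via-endOn : ∀ {v} → colour v ≡ not c →
                             sum (λ e → [ does (endOn (not c) e ≟ v) ]· φ e) ≡ starWeight v
      starWeight-via-endOn v∼ = sum-cong-≗ λ e → cong (λ x → [ x ]· φ e) (sym (starAt-on-side v∼ e))

      ∑-far⁺ : sum (λ e → [ inFar⁺ (endOn (not c) e) ]· φ e) ≡ count inFar + (starWeight b + starWeight d)
      ∑-far⁺ = begin
        sum (λ e → [ inFar⁺ (β e) ]· φ e)
          ≡⟨ sum-cong-≗ (λ e → far⁺-split (β e) (φ e)) ⟩
        sum (λ e → [ inFar (β e) ]· φ e + ([ does (β e ≟ b) ]· φ e + [ does (β e ≟ d) ]· φ e))
          ≡⟨ ∑-distrib-+ (λ e → [ inFar (β e) ]· φ e) _ ⟩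
        sum (λ e → [ inFar (β e) ]· φ e) + sum (λ e → [ does (β e ≟ b) ]· φ e + [ does (β e ≟ d) ]· φ e)
          ≡⟨ cong₂ _+_ ∑-far (∑-distrib-+ (λ e → [ does (β e ≟ b) ]· φ e) _) ⟩
        count inFar + (sum (λ e → [ does (β e ≟ b) ]· φ e) + sum (λ e → [ does (β e ≟ d) ]· φ e))
          ≡⟨ cong (count inFar +_) (cong₂ _+_ (starWeight-via-endOn (colour-endOn (not c) e₀))
                                              (starWeight-via-endOn (colour-endOn (not c) f₀))) ⟩
        count inFar + (starWeight b + starWeight d) ∎
        where
        open ≡-Reasoning
        β : Edge G → Vertex G
        β = endOn (not c)

      near⇒far⁺ : ∀ e → inNear (endOn c e) ≡ true → inFar⁺ (endOn (not c) e) ≡ true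
      near⇒far⁺ e eq with dec-true⁻¹ (near? (endOn c e)) eq | blocked? (endOn (not c) e)
      ... | _ | yes (inj₁ β∈e₀) = far⁺-intro (inj₂ (inj₁ (sym (endOn-unique β∈e₀ (colour-endOn (not c) e)))))
      ... | _ | yes (inj₂ β∈f₀) = far⁺-intro (inj₂ (inj₂ (sym (endOn-unique β∈f₀ (colour-endOn (not c) e)))))
      ... | p , α∼c | no β-free = far⁺-intro (inj₁ (p ▷ (e , endOn-samePair c e , inj₁ (α∼c , usable-e)) , β≁c))
        where
        usable-e : Usable e
        usable-e u u∈e with samePair-endpoint (endOn-samePair c e) u∈e
        ... | inj₁ refl = reachable-unblocked p
        ... | inj₂ refl = β-free
        β≁c : colour (endOn (not c) e) ≢ c
        β≁c β∼c = not-¬ β∼c (colour-endOn (not c) e)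

      T : EdgeSet G
      T e = inFar⁺ (endOn (not c) e) ∧ not (inNear (endOn c e))

      ∑-far⁺-split : sum (λ e → [ inFar⁺ (endOn (not c) e) ]· φ e) ≡ sum (λ e → [ inNear (endOn c e) ]· φ e) + W T
      ∑-far⁺-split = trans (sum-cong-≗ λ e → []·-split-⇒ (inNear (endOn c e)) _ (φ e) (near⇒far⁺ e))
                           (∑-distrib-+ (λ e → [ inNear (endOn c e) ]· φ e) _)

      excess : starWeight b + starWeight d ≡ 1ℚ + W T
      excess = ∙-cancelˡ (count inFar) (starWeight b + starWeight d) (1ℚ + W T) (begin
        count inFar + (starWeight b + starWeight d)    ≡⟨ ∑-far⁺ ⟨
        sum (λ e → [ inFar⁺ (endOn (not c) e) ]· φ e) ≡⟨ ∑-far⁺-split ⟩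
        sum (λ e → [ inNear (endOn c e) ]· φ e) + W T ≡⟨ cong (_+ W T) (trans ∑-near count-near) ⟩
        (1ℚ + count inFar) + W T                       ≡⟨ cong (_+ W T) (ℚ.+-comm 1ℚ (count inFar)) ⟩
        (count inFar + 1ℚ) + W T                       ≡⟨ ℚ.+-assoc (count inFar) 1ℚ (W T) ⟩
        count inFar + (1ℚ + W T)                       ∎)
        where open ≡-Reasoning

      T-contains : ∀ {e} → endOn (not c) e ≡ b ⊎ endOn (not c) e ≡ d → Blocked (endOn c e) → T e ≡ true
      T-contains {e} β∈bd α-blocked = cong₂ (λ x y → x ∧ not y) (far⁺-intro (inj₂ β∈bd))
        (dec-false (near? (endOn c e)) λ (p , _) → reachable-unblocked p α-blocked)

      absurd : ⊥
      absurd = disjoint-pair-no-excess (endOn-incident (not c) e₀) (endOn-incident (not c) f₀) disjoint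
                 (T-contains (inj₁ refl) (inj₁ (endOn-incident c e₀)))
                 (T-contains (inj₂ refl) (inj₂ (endOn-incident c f₀))) excess

    cover : (M : Matching) → ∀ {s} → Needy s → ¬ M covers s →
            ∃[ M′ ] ((∀ {u} → Needy u → M covers u → M′ covers u) × M′ covers s)
    cover M {s} needy-s s-free
      with any? (λ y → altWalk? M s y ×-dec (¬? (colour y Bool.≟ colour s) ×-dec ¬? (covers? M y)))
    ... | yes (y , p , y≁s , y-free) with augment (altLength p) M s-free p ℕ.≤-refl y≁s y-free
    ...   | M′ , grows , covers-s , _ = M′ , (λ _ → grows) , covers-s
    cover M {s} needy-s s-free | no no-free
      with any? (λ x → altWalk? M s x ×-dec ((colour x Bool.≟ colour s) ×-dec (¬? (x ≟ s) ×-dec ¬? (needy? x))))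
    ... | yes (x , q , x∼s , x≢s , ¬needy) with release (altLength q) M s-free q ℕ.≤-refl x∼s x≢s
    ...   | M′ , grows , covers-s = M′ , (λ needy-u → grows λ { refl → ¬needy needy-u }) , covers-s
    cover M {s} needy-s s-free | no no-free | no no-spare = ⊥-elim (Stuck.absurd M needy-s s-free no-free no-spare)

    cover-all : ∀ (L : List (Vertex G)) → ∃[ M ] (∀ {u} → u ∈ L → Needy u → M covers u)
    cover-all []      = ∅ , λ ()
    cover-all (v ∷ L) with cover-all L
    ... | M , covers-L with needy? v | covers? M v
    ... | no ¬needy | _      = M , λ { (here refl) needy → contradiction needy ¬needy ; (there u∈L) → covers-L u∈L }
    ... | yes _     | yes cv = M , λ { (here refl) _ → cv ; (there u∈L) → covers-L u∈L }
    ... | yes needy | no free with cover M needy free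
    ...   | M′ , grows , covers-v =
      M′ , λ { (here refl) _ → covers-v ; (there u∈L) needy-u → grows needy-u (covers-L u∈L needy-u) }

    needy-covered : ∃[ M ] (∀ {u} → Needy u → M covers u)
    needy-covered with cover-all (allFin n)
    ... | M , covers = M , covers (∈-allFin _)

    perfect-internal : ∀ {v} → CompEdge G v e₀ → CompEdge G v f₀ →
                       ∃[ N ] (IsCompPIM G v N × N e₀ ≡ true × N f₀ ≡ true)
    perfect-internal {v} e₀∈ f₀∈ =
      N , ((N⊆comp , λ _ _ _ → N-matching) , pim) ,
      updateAt-updates e₀ (insertEdge f₀ R) , insertEdge-⊇ e₀ (insertEdge f₀ R) (updateAt-updates f₀ R)
      where
      M : Matching
      M = proj₁ needy-covered
      inR? : ∀ k → Dec (edges M k ≡ true × CompEdge G v k)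
      inR? k = (edges M k Bool.≟ true) ×-dec compEdge? v k
      R : EdgeSet G
      R k = does (inR? k)
      N : EdgeSet G
      N = insertEdge e₀ (insertEdge f₀ R)
      R-avoids : ∀ {u} → Blocked u → ¬ Covered G R u
      R-avoids blocked (k , Rk , u∈k) = usable M (proj₁ (dec-true⁻¹ (inR? k) Rk)) _ u∈k blocked
      e₀-free : ∀ {u} → Incident G u e₀ → ¬ Covered G (insertEdge f₀ R) u
      e₀-free {u} u∈e₀ c with covered-insertEdge⁻ f₀ R c
      ... | inj₁ u∈f₀ = disjoint u u∈e₀ u∈f₀
      ... | inj₂ cR   = R-avoids (inj₁ u∈e₀) cR
      N-matching : IsMatching N
      N-matching = insertEdge-isMatching e₀
        (insertEdge-isMatching f₀ (isMatching-⊆ (isMatching M) λ {k} → proj₁ ∘ dec-true⁻¹ (inR? k)) (R-avoids ∘ inj₂))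
        e₀-free
      N⊆comp : ∀ k → N k ≡ true → CompEdge G v k
      N⊆comp k Nk with insertEdge-member e₀ (insertEdge f₀ R) Nk
      ... | inj₁ refl = e₀∈
      ... | inj₂ N′k with insertEdge-member f₀ R N′k
      ... | inj₁ refl = f₀∈
      ... | inj₂ Rk   = proj₂ (dec-true⁻¹ (inR? k) Rk)
      pim : ∀ u → InComp G v u → ¬ Covered G N u → Deg1 G u
      pim u r u-free with blocked? u | deg≥2? u
      ... | yes (inj₁ u∈e₀) | _ = ⊥-elim (u-free (covered-insertEdge-end e₀ (insertEdge f₀ R) u∈e₀))
      ... | yes (inj₂ u∈f₀) | _ =
        ⊥-elim (u-free (covered-⊆ (insertEdge-⊇ e₀ (insertEdge f₀ R)) (covered-insertEdge-end f₀ R u∈f₀)))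
      ... | no free | yes deg with proj₂ needy-covered (deg , free)
      ...   | k , Mk , u∈k = ⊥-elim (u-free (k , insertEdge-⊇ e₀ _ (insertEdge-⊇ f₀ R Rk) , u∈k))
        where
        Rk : R k ≡ true
        Rk = dec-true (inR? k) (Mk , reach⇒compEdge r u∈k)
      pim u r u-free | no _ | no ¬deg with noIso u
      ... | g , u∈g = g , u∈g , λ f u∈f → ¬deg≥2⇒unique ¬deg u∈g u∈f

lemma9 : (G : Graph) → Bipartite G → Equistarable G →
    (v : Vertex G) → CompIsStar G v ⊎ Comp2IntExt G v
lemma9 G bip (noIso , φ , φ≥0 , maximal⇔1) v with GraphFacts.has-2-matching? G v
... | no none  = inj₁ (Bipartition.no-2-matching⇒star G bip noIso v none)
... | yes some = inj₂ (some , extend)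
  where
  extend : ∀ e f → Is2Matching G v e f → ∃[ M ] (IsCompPIM G v M × M e ≡ true × M f ≡ true)
  extend e f (e∈ , f∈ , _ , disjoint) =
    Covering.AvoidingPair.perfect-internal G bip noIso φ φ≥0 maximal⇔1 {e} {f} disjoint e∈ f∈
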